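{- Let $X$ be a finite set and $R$ a self-relation on $X$ with eventual period $(j, p)$. If $\operatorname{Dom} R = X$, then $K_{R^j} = K_{R^{j+i}}$ for every $i \in \mathbb{N}$. If $\operatorname{Im} R = X$, then $L_{R^j} = L_{R^{j+i}}$ for every $i \in \mathbb{N}$.
   Context: A self-relation on $X$ is $R \subset X \times X$; write $x R y$ for $(x,y)\in R$. Composition: $R_2 \circ R_1 = \{(x,z) : \exists y,\ x R_1 y,\ y R_2 z\}$; powers $R^0 = \mathrm{Id}_X$, $R^n = R\circ R^{n-1}$. The eventual period of $R$ is the pair $(j,p)$ where $j$ is the least positive integer such that $R^j = R^{j+p}$ for some $p > 0$, and $p$ is the least such positive integer. $\operatorname{Dom} R = \{x : \exists y,\ xRy\}$, $\operatorname{Im} R = \{y : \exists x,\ xRy\}$. For $S \subset X\times X$, the Dowker complex $K_S$ is the abstract simplicial complex on $X$ whose simplices are the nonempty sets $\{x_1,\ldots,x_n\}$ such that some $y$ satisfies $x_i S y$ for all $i$; $L_S$ is the abstract simplicial complex on $X$ whose simplices are the nonempty sets $\{y_1,\ldots,y_m\}$ such that some $x$ satisfies $x S y_i$ for all $i$. -}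

module Defs where

open import Level using (0ℓ)
open import Data.Nat using (ℕ; zero; suc; _+_; _≤_; _<_)
open import Data.Fin using (Fin)
open import Data.Fin.Subset using (Subset; _∈_; Nonempty)
open import Data.Product using (Σ; ∃; _×_; _,_)
open import Relation.Binary.PropositionalEquality using (_≡_)
open import Relation.Nullary using (¬_)
open import Function.Bundles using (_⇔_)

SelfRel : ℕ → Set₁
SelfRel n = Fin n → Fin n → Set

_⊚_ : ∀ {n} → SelfRel n → SelfRel n → SelfRel n
(R₂ ⊚ R₁) x z = ∃ λ y → R₁ x y × R₂ y z

_^[_] : ∀ {n} → SelfRel n → ℕ → SelfRel n
R ^[ zero ]  = _≡_
R ^[ suc k ] = R ⊚ (R ^[ k ])

_≐_ : ∀ {n} → SelfRel n → SelfRel n → Set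
R ≐ S = ∀ x y → R x y ⇔ S x y

IsEventualPeriod : ∀ {n} → SelfRel n → ℕ → ℕ → Set
IsEventualPeriod R j p =
  1 ≤ j × 1 ≤ p × (R ^[ j ]) ≐ (R ^[ j + p ])
  × (∀ j' p' → 1 ≤ j' → j' < j → 1 ≤ p' → ¬ ((R ^[ j' ]) ≐ (R ^[ j' + p' ])))
  × (∀ p' → 1 ≤ p' → p' < p → ¬ ((R ^[ j ]) ≐ (R ^[ j + p' ])))

Dom-full : ∀ {n} → SelfRel n → Set
Dom-full {n} R = ∀ (x : Fin n) → ∃ λ y → R x y

Im-full : ∀ {n} → SelfRel n → Set
Im-full {n} R = ∀ (y : Fin n) → ∃ λ x → R x y

-- Simplices of the Dowker complex K_S: nonempty σ ⊆ X with some y such that x S y for all x ∈ σ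
IsSimplexK : ∀ {n} → SelfRel n → Subset n → Set
IsSimplexK {n} S σ = Nonempty σ × ∃ λ (y : Fin n) → ∀ x → x ∈ σ → S x y

IsSimplexL : ∀ {n} → SelfRel n → Subset n → Set
IsSimplexL {n} S σ = Nonempty σ × ∃ λ (x : Fin n) → ∀ y → y ∈ σ → S x y

SameK : ∀ {n} → SelfRel n → SelfRel n → Set
SameK {n} S T = ∀ (σ : Subset n) → IsSimplexK S σ ⇔ IsSimplexK T σ

SameL : ∀ {n} → SelfRel n → SelfRel n → Set
SameL {n} S T = ∀ (σ : Subset n) → IsSimplexL S σ ⇔ IsSimplexL T σ

{-# OPTIONS --safe #-}
module Submission where

-- If Dom R = X then every R^m has full domain, so a common R^a-successor of a
-- simplex can be pushed forward along R^m: K_{R^a} ⊆ K_{R^(a+m)}. Hence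
-- K_{R^j} ⊆ K_{R^(j+i)} ⊆ K_{R^(j+i+i(p-1))} = K_{R^(j+ip)} = K_{R^j}, the last
-- step by periodicity. Dually, Im R = X makes L_{R^a} grow with a.

open import Defs
open import Level using (0ℓ)
open import Data.Nat using (ℕ; zero; suc; _+_; _*_)
open import Data.Nat.Properties using (+-comm; +-assoc; *-suc; +-identityʳ)
open import Data.Product using (_×_; _,_)
open import Function.Bundles using (_⇔_; mk⇔; Equivalence)
open import Function.Properties.Equivalence using (⇔-isEquivalence)
open import Relation.Binary.Structures using (IsEquivalence)
open import Relation.Binary.PropositionalEquality using (_≡_; refl; sym; trans; cong)

open IsEquivalence (⇔-isEquivalence {ℓ = 0ℓ})
  using () renaming (refl to ⇔-refl; sym to ⇔-sym; trans to ⇔-trans)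
open Equivalence using (to; from)

module _ {n : ℕ} where

  ≐-sym : {S T : SelfRel n} → S ≐ T → T ≐ S
  ≐-sym e x y = ⇔-sym (e x y)

  ≐-trans : {S T U : SelfRel n} → S ≐ T → T ≐ U → S ≐ U
  ≐-trans e f x y = ⇔-trans (e x y) (f x y)

  IsSimplexK-resp-≐ : {S T : SelfRel n} → S ≐ T →
    ∀ σ → IsSimplexK S σ → IsSimplexK T σ
  IsSimplexK-resp-≐ e σ (ne , y , h) = ne , y , λ x x∈σ → to (e x y) (h x x∈σ)

  IsSimplexL-resp-≐ : {S T : SelfRel n} → S ≐ T →
    ∀ σ → IsSimplexL S σ → IsSimplexL T σ
  IsSimplexL-resp-≐ e σ (ne , x , h) = ne , x , λ y y∈σ → to (e x y) (h y y∈σ)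

  IsSimplexK-⊚ : {S T : SelfRel n} → Dom-full T →
    ∀ σ → IsSimplexK S σ → IsSimplexK (T ⊚ S) σ
  IsSimplexK-⊚ dom σ (ne , y , h) with dom y
  ... | z , yTz = ne , z , λ x x∈σ → y , h x x∈σ , yTz

  IsSimplexL-⊚ : {S T : SelfRel n} → Im-full T →
    ∀ σ → IsSimplexL S σ → IsSimplexL (S ⊚ T) σ
  IsSimplexL-⊚ im σ (ne , x , h) with im x
  ... | w , wTx = ne , w , λ y y∈σ → x , wTx , h y y∈σ

module _ {n : ℕ} (R : SelfRel n) where

  ^-+ : ∀ k m {x z} → ((R ^[ k ]) ⊚ (R ^[ m ])) x z → (R ^[ k + m ]) x z
  ^-+ zero    m (y , xRᵐy , refl) = xRᵐy
  ^-+ (suc k) m (y , xRᵐy , (w , yRᵏw , wRz)) = w , ^-+ k m (y , xRᵐy , yRᵏw) , wRz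

  ^-⊚-≐ : ∀ k m → (R ^[ k + m ]) ≐ ((R ^[ k ]) ⊚ (R ^[ m ]))
  ^-⊚-≐ k m x z = mk⇔ (split k) (^-+ k m)
    where
    split : ∀ k {z} → (R ^[ k + m ]) x z → ((R ^[ k ]) ⊚ (R ^[ m ])) x z
    split zero {z} xRᵐz = z , xRᵐz , refl
    split (suc k) (w , xRᵏ⁺ᵐw , wRz) with split k xRᵏ⁺ᵐw
    ... | y , xRᵐy , yRᵏw = y , xRᵐy , (w , yRᵏw , wRz)

  ^-cong : ∀ {a b} → a ≡ b → (R ^[ a ]) ≐ (R ^[ b ])
  ^-cong refl x y = ⇔-refl

  ^-congˡ : ∀ k {a b} → (R ^[ a ]) ≐ (R ^[ b ]) → (R ^[ k + a ]) ≐ (R ^[ k + b ])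
  ^-congˡ zero    e = e
  ^-congˡ (suc k) e x z = mk⇔
    (λ { (y , r , s) → y , to   (^-congˡ k e x y) r , s })
    (λ { (y , r , s) → y , from (^-congˡ k e x y) r , s })

  ^-periodic : ∀ j p → (R ^[ j ]) ≐ (R ^[ j + p ]) → ∀ c → (R ^[ j + c * p ]) ≐ (R ^[ j ])
  ^-periodic j p e zero    = ^-cong (+-identityʳ j)
  ^-periodic j p e (suc c) =
    ≐-trans (^-cong j+[p+cp]≡cp+[j+p])
      (≐-trans (^-congˡ (c * p) (≐-sym e))
        (≐-trans (^-cong (+-comm (c * p) j)) (^-periodic j p e c)))
    where
    open Relation.Binary.PropositionalEquality.≡-Reasoning
    j+[p+cp]≡cp+[j+p] : j + (p + c * p) ≡ c * p + (j + p)
    j+[p+cp]≡cp+[j+p] = begin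
      j + (p + c * p) ≡⟨ sym (+-assoc j p (c * p)) ⟩
      (j + p) + c * p ≡⟨ +-comm (j + p) (c * p) ⟩
      c * p + (j + p) ∎

  Dom-full-^ : Dom-full R → ∀ m → Dom-full (R ^[ m ])
  Dom-full-^ dom zero    x = x , refl
  Dom-full-^ dom (suc m) x with Dom-full-^ dom m x
  ... | y , xRᵐy with dom y
  ... | z , yRz = z , y , xRᵐy , yRz

  Im-full-^ : Im-full R → ∀ m → Im-full (R ^[ m ])
  Im-full-^ im zero    z = z , refl
  Im-full-^ im (suc m) z with im z
  ... | y , yRz with Im-full-^ im m y
  ... | x , xRᵐy = x , y , xRᵐy , yRz

  growing-constant-from-period :
    (P : SelfRel n → Set) → (∀ {S T} → S ≐ T → P S → P T) →
    (∀ a m → P (R ^[ a ]) → P (R ^[ a + m ])) →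
    ∀ j p → (R ^[ j ]) ≐ (R ^[ j + suc p ]) → ∀ i → P (R ^[ j ]) ⇔ P (R ^[ j + i ])
  growing-constant-from-period P resp grow j p e i =
    mk⇔ (grow j i) (λ P[j+i] → resp j+i+ip≐j (grow (j + i) (i * p) P[j+i]))
    where
    j+i+ip≐j : (R ^[ j + i + i * p ]) ≐ (R ^[ j ])
    j+i+ip≐j = ≐-trans (^-cong (trans (+-assoc j i (i * p)) (cong (j +_) (sym (*-suc i p)))))
                       (^-periodic j (suc p) e i)

  IsSimplexK-^-grow : Dom-full R → ∀ σ a m →
    IsSimplexK (R ^[ a ]) σ → IsSimplexK (R ^[ a + m ]) σ
  IsSimplexK-^-grow dom σ a m simplex =
    IsSimplexK-resp-≐ (≐-sym (≐-trans (^-cong (+-comm a m)) (^-⊚-≐ m a))) σ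
      (IsSimplexK-⊚ (Dom-full-^ dom m) σ simplex)

  IsSimplexL-^-grow : Im-full R → ∀ σ a m →
    IsSimplexL (R ^[ a ]) σ → IsSimplexL (R ^[ a + m ]) σ
  IsSimplexL-^-grow im σ a m simplex =
    IsSimplexL-resp-≐ (≐-sym (^-⊚-≐ a m)) σ (IsSimplexL-⊚ (Im-full-^ im m) σ simplex)

mainTheorem8 : ∀ (n : ℕ) (R : SelfRel n) (j p : ℕ) → IsEventualPeriod R j p →
    (Dom-full R → ∀ (i : ℕ) → SameK (R ^[ j ]) (R ^[ j + i ]))
    × (Im-full R → ∀ (i : ℕ) → SameL (R ^[ j ]) (R ^[ j + i ]))
mainTheorem8 n R j zero    (_ , () , _)
mainTheorem8 n R j (suc p) (_ , _ , period , _) =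
  (λ dom i σ → growing-constant-from-period R (λ S → IsSimplexK S σ)
                 (λ e → IsSimplexK-resp-≐ e σ) (IsSimplexK-^-grow R dom σ) j p period i)
  , (λ im i σ → growing-constant-from-period R (λ S → IsSimplexL S σ)
                 (λ e → IsSimplexL-resp-≐ e σ) (IsSimplexL-^-grow R im σ) j p period i)
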